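{- Let $n$ be a positive integer which is either near superperfect or deficient superperfect. Then $\sigma(n)\le 3n$.
   Context: $\sigma(m)$ denotes the sum of the positive divisors of $m$. A positive integer $n$ is near superperfect if $2n+d=\sigma(\sigma(n))$ for some positive divisor $d$ of $n$, and deficient superperfect if $2n-d=\sigma(\sigma(n))$ for some positive divisor $d$ of $n$. -}

module Defs where

open import Data.Nat using (ℕ; suc; _+_; _*_; _∸_; _≤_)
open import Data.Nat.Divisibility using (_∣_; _∣?_)
open import Data.List using (List; filter; upTo; map)
open import Data.Nat.ListAction using (sum)
open import Relation.Binary.PropositionalEquality using (_≡_)
open import Data.Product using (∃-syntax; _×_)
open import Data.Sum using (_⊎_)

divisors : ℕ → List ℕ
divisors m = filter (_∣? m) (map suc (upTo m))

-- σ m : sum of the positive divisors of m (σ 0 = 0 by this convention; irrelevant here)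
σ : ℕ → ℕ
σ m = sum (divisors m)

NearSuperperfect : ℕ → Set
NearSuperperfect n = ∃[ d ] (1 ≤ d × d ∣ n × 2 * n + d ≡ σ (σ n))

DeficientSuperperfect : ℕ → Set
DeficientSuperperfect n = ∃[ d ] (1 ≤ d × d ∣ n × d ≤ 2 * n × 2 * n ∸ d ≡ σ (σ n))

{-# OPTIONS --safe #-}
module Submission where

-- Every m is one of its own divisors, so σ n ≤ σ (σ n) = 2n ± d, and d ≤ n since d ∣ n.

open import Defs
open import Data.Nat using (ℕ; _*_; _≤_; zero; suc; _+_; z≤n; NonZero; >-nonZero)
open import Data.Nat.Properties
open import Data.Nat.Divisibility using (_∣?_; ∣-refl; ∣⇒≤)
open import Data.Nat.ListAction using (sum)
open import Data.List using (List; _∷_)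
open import Data.List.Membership.Propositional using (_∈_)
open import Data.List.Membership.Propositional.Properties using (∈-filter⁺; ∈-map⁺; ∈-upTo⁺)
open import Data.List.Relation.Unary.Any using (here; there)
open import Data.Sum using (_⊎_; inj₁; inj₂)
open import Data.Product using (_,_)
open import Relation.Binary.PropositionalEquality using (_≡_; refl; subst)

∈⇒≤sum : ∀ {x} {xs : List ℕ} → x ∈ xs → x ≤ sum xs
∈⇒≤sum {xs = y ∷ ys} (here refl) = m≤m+n y (sum ys)
∈⇒≤sum {xs = y ∷ ys} (there x∈ys) = ≤-trans (∈⇒≤sum x∈ys) (m≤n+m (sum ys) y)

m∈divisors[m] : ∀ m → .{{NonZero m}} → m ∈ divisors m
m∈divisors[m] (suc k) = ∈-filter⁺ (_∣? suc k) (∈-map⁺ suc (∈-upTo⁺ ≤-refl)) ∣-refl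

m≤σ[m] : ∀ m → m ≤ σ m
m≤σ[m] zero    = z≤n
m≤σ[m] (suc k) = ∈⇒≤sum (m∈divisors[m] (suc k))

nearSuperperfect⇒σσ≤3n : ∀ {n} .{{_ : NonZero n}} → NearSuperperfect n → σ (σ n) ≤ 3 * n
nearSuperperfect⇒σσ≤3n {n} (d , _ , d∣n , 2n+d≡σσn) =
  subst (_≤ 3 * n) 2n+d≡σσn (begin
    2 * n + d  ≤⟨ +-monoʳ-≤ (2 * n) (∣⇒≤ d∣n) ⟩
    2 * n + n  ≡⟨ +-comm (2 * n) n ⟩
    3 * n      ∎)
  where open ≤-Reasoning

deficientSuperperfect⇒σσ≤2n : ∀ {n} → DeficientSuperperfect n → σ (σ n) ≤ 2 * n
deficientSuperperfect⇒σσ≤2n {n} (d , _ , _ , _ , 2n∸d≡σσn) = subst (_≤ 2 * n) 2n∸d≡σσn (m∸n≤m (2 * n) d)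

mainTheorem11 : (n : ℕ) → 1 ≤ n → NearSuperperfect n ⊎ DeficientSuperperfect n → σ n ≤ 3 * n
mainTheorem11 n 1≤n (inj₁ near) =
  ≤-trans (m≤σ[m] (σ n)) (nearSuperperfect⇒σσ≤3n {{>-nonZero 1≤n}} near)
mainTheorem11 n _ (inj₂ deficient) =
  ≤-trans (m≤σ[m] (σ n)) (≤-trans (deficientSuperperfect⇒σσ≤2n deficient) (m≤n+m (2 * n) n))
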